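{- Let $G$ be a finite simple graph on $n$ vertices and let $P=v_1v_2\cdots v_k$ be an $o_{ -1}$-path of $G$. Then there exists a path of $G$ which contains all the vertices $v_1,\dots,v_k$.
   Context: For a vertex $v$, $d(v)$ denotes its degree in $G$. A sequence of distinct vertices $v_1v_2\cdots v_k$ of $G$ is called an $o_{ -1}$-path of $G$ if for every $i\in\{1,\dots,k-1\}$, either $v_iv_{i+1}\in E(G)$ or $d(v_i)+d(v_{i+1})\ge n-1$. -}

module Defs where

open import Data.Nat using (ℕ; _+_; _∸_; _≥_)
open import Data.Fin using (Fin)
open import Data.List using (List; []; _∷_; filter; length; allFin)
open import Data.List.Relation.Unary.Unique.Propositional using (Unique)
open import Data.Product using (_×_)
open import Data.Sum using (_⊎_)
open import Relation.Nullary using (¬_; Dec)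

record SimpleGraph (n : ℕ) : Set₁ where
  field
    Adj     : Fin n → Fin n → Set
    adj?    : ∀ u v → Dec (Adj u v)
    symm    : ∀ {u v} → Adj u v → Adj v u
    irrefl  : ∀ {v} → ¬ Adj v v

open SimpleGraph public

degree : ∀ {n} (G : SimpleGraph n) → Fin n → ℕ
degree {n} G v = length (filter (adj? G v) (allFin n))

data Chain {n : ℕ} (R : Fin n → Fin n → Set) : List (Fin n) → Set where
  []   : Chain R []
  [-]  : ∀ x → Chain R (x ∷ [])
  _∷_  : ∀ {x y xs} → R x y → Chain R (y ∷ xs) → Chain R (x ∷ y ∷ xs)

O₋₁Rel : ∀ {n} → SimpleGraph n → Fin n → Fin n → Set
O₋₁Rel {n} G u v = Adj G u v ⊎ (degree G u + degree G v ≥ n ∸ 1)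

IsO₋₁Path : ∀ {n} → SimpleGraph n → List (Fin n) → Set
IsO₋₁Path G vs = Unique vs × Chain (O₋₁Rel G) vs

IsPath : ∀ {n} → SimpleGraph n → List (Fin n) → Set
IsPath G vs = Unique vs × Chain (Adj G) vs

-- Call a pair {x, y} of vertices good if d(x) + d(y) ≥ n - 1. The key fact is that adding a
-- good pair as an edge creates no new vertex sets covered by paths: then the o₋₁-path is a path
-- of G plus its good steps, and these edges can be removed again one at a time.
-- So let x y be an edge of a path, with {x, y} good, splitting it into L ending at x and R
-- starting at y. If x is adjacent to a vertex r of R that is last on R or whose successor on R
-- is adjacent to y, reversing the segment of R from y to r avoids x y; the same holds with L and
-- R exchanged; and a common neighbour of x and y outside the path can be inserted between them.
-- Otherwise x and y together have fewer than |L| neighbours in L, fewer than |R| in R and at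
-- most as many as there are vertices outside the path, so d(x) + d(y) ≤ n - 2.
module Submission where

open import Defs
open import Data.Nat using (ℕ; suc; _+_; _∸_; _≤_; _<_; z≤n; s≤s)
open import Data.Nat.Properties using (module ≤-Reasoning; +-suc; +-comm; +-mono-≤; ∸-monoˡ-≤; ≤-trans; ≤-reflexive; n≤1+n; <⇒≱)
open import Data.Nat.Tactic.RingSolver using (solve-∀)
open import Data.Fin using (Fin; _≟_)
open import Data.List using (List; []; _∷_; _++_; _ʳ++_; length; filter; allFin)
open import Data.List.Properties using (filter-++; filter-reject; length-++; length-tabulate; ++-identityʳ; ʳ++-defn)
open import Data.List.Membership.Propositional using (_∈_; _∉_; find)
open import Data.List.Membership.Propositional.Properties using (∈-filter⁺; ∈-filter⁻; ∈-++⁺ˡ; ∈-++⁺ʳ; ∈-allFin)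
open import Data.List.Membership.Propositional.Properties.WithK using (unique∧set⇒bag)
open import Data.List.Relation.Unary.Any using (here; there; any?)
open import Data.List.Relation.Unary.All using (All; []; _∷_)
open import Data.List.Relation.Unary.All.Properties using (¬Any⇒All¬)
open import Data.List.Relation.Unary.AllPairs using ([]; _∷_)
open import Data.List.Relation.Unary.Unique.Propositional using (Unique)
open import Data.List.Relation.Unary.Unique.Propositional.Properties using (allFin⁺; filter⁺; ++⁺; Unique[x∷xs]⇒x∉xs)
open import Data.List.Relation.Binary.BagAndSetEquality using (∼bag⇒↭)
open import Data.List.Relation.Binary.Permutation.Propositional using (_↭_; ↭-refl; ↭-sym; ↭-trans; ↭-reflexive; prep; ↭⇒↭ₛ)
open import Data.List.Relation.Binary.Permutation.Propositional.Properties using (filter-↭; ∈-resp-↭; ↭-length; ↭-reverse; ++⁺ˡ; ++⁺ʳ; shift)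
import Data.List.Relation.Binary.Permutation.Setoid.Properties as Setoid↭
open import Data.List.Relation.Binary.Sublist.Propositional using (⊆-refl)
import Data.List.Relation.Binary.Sublist.Propositional.Properties as Sublist
open import Data.Product using (Σ; _×_; _,_)
open import Data.Sum using (_⊎_; inj₁; inj₂)
open import Data.Empty using (⊥-elim)
open import Function.Base using (_∘_; id)
open import Function.Bundles using (mk⇔)
open import Relation.Nullary using (¬_; Dec; yes; no; ¬?)
open import Relation.Nullary.Decidable using (_×-dec_; _⊎-dec_)
open import Relation.Unary using (Decidable; _⊆_)
open import Relation.Binary.PropositionalEquality using (_≡_; _≢_; refl; sym; trans; cong; cong₂; subst; setoid)

private
  variable
    n : ℕ
    A : Set

count : {P : A → Set} → Decidable P → List A → ℕ
count P? xs = length (filter P? xs)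

module _ {P : A → Set} (P? : Decidable P) where

  count-++ : ∀ xs ys → count P? (xs ++ ys) ≡ count P? xs + count P? ys
  count-++ xs ys = trans (cong length (filter-++ P? xs ys)) (length-++ (filter P? xs))

  count-↭ : ∀ {xs ys} → xs ↭ ys → count P? xs ≡ count P? ys
  count-↭ xs↭ys = ↭-length (filter-↭ P? xs↭ys)

  count-reject : ∀ {x} xs → ¬ P x → count P? (x ∷ xs) ≡ count P? xs
  count-reject xs ¬px = cong length (filter-reject P? ¬px)

  module _ {Q : A → Set} (Q? : Decidable Q) where

    count-mono : P ⊆ Q → ∀ xs → count P? xs ≤ count Q? xs
    count-mono P⊆Q xs = Sublist.length-mono-≤ (Sublist.filter⁺ P? Q? (λ { refl → P⊆Q }) (⊆-refl {x = xs}))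

    count-∷-≤ : ∀ {a b xs ys m} → ¬ (P a × Q b) → count P? xs + count Q? ys ≤ m →
                count P? (a ∷ xs) + count Q? (b ∷ ys) ≤ suc m
    count-∷-≤ {a} {b} {xs} ¬pq le with P? a | Q? b
    ... | yes pa | yes qb = ⊥-elim (¬pq (pa , qb))
    ... | yes _  | no _   = s≤s le
    ... | no _   | yes _  = ≤-trans (≤-reflexive (+-suc (count P? xs) _)) (s≤s le)
    ... | no _   | no _   = ≤-trans le (n≤1+n _)

    count+count≤length : ∀ {xs} → All (λ x → ¬ (P x × Q x)) xs → count P? xs + count Q? xs ≤ length xs
    count+count≤length []            = z≤n
    count+count≤length (¬pq ∷ ¬pqs) = count-∷-≤ ¬pq (count+count≤length ¬pqs)

unique-resp-↭ : {xs ys : List A} → xs ↭ ys → Unique xs → Unique ys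
unique-resp-↭ {A} xs↭ys = Setoid↭.Unique-resp-↭ (setoid A) (↭⇒↭ₛ xs↭ys)

ʳ++-↭-++ : (xs ys : List A) → xs ʳ++ ys ↭ xs ++ ys
ʳ++-↭-++ xs ys = subst (_↭ xs ++ ys) (sym (ʳ++-defn xs)) (++⁺ʳ ys (↭-reverse xs))

ʳ++-∉ : ∀ (xs : List A) {x ys} → Unique (xs ʳ++ x ∷ ys) → x ∉ ys
ʳ++-∉ xs {x} {ys} u x∈ys =
  Unique[x∷xs]⇒x∉xs (unique-resp-↭ (ʳ++-↭-++ (x ∷ xs) ys) u) (∈-++⁺ʳ xs x∈ys)

module _ {n : ℕ} where

  _∈?_ : (v : Fin n) (S : List (Fin n)) → Dec (v ∈ S)
  v ∈? S = any? (v ≟_) S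

  outside : List (Fin n) → List (Fin n)
  outside S = filter (λ v → ¬? (v ∈? S)) (allFin n)

  ∈-outside⁻ : ∀ {v} S → v ∈ outside S → v ∉ S
  ∈-outside⁻ {v} S v∈ = let _ , v∉S = ∈-filter⁻ (λ v → ¬? (v ∈? S)) {xs = allFin n} v∈ in v∉S

  ++-outside-↭ : ∀ S → Unique S → S ++ outside S ↭ allFin n
  ++-outside-↭ S uS = ∼bag⇒↭ (unique∧set⇒bag uS+ (allFin⁺ n) (mk⇔ (λ _ → ∈-allFin _) inS+))
    where
    uS+ : Unique (S ++ outside S)
    uS+ = ++⁺ uS (filter⁺ (λ v → ¬? (v ∈? S)) (allFin⁺ n)) (λ (v∈S , v∈O) → ∈-outside⁻ S v∈O v∈S)
    inS+ : ∀ {v} → v ∈ allFin n → v ∈ S ++ outside S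
    inS+ {v} _ with v ∈? S
    ... | yes v∈S = ∈-++⁺ˡ v∈S
    ... | no v∉S  = ∈-++⁺ʳ S (∈-filter⁺ (λ v → ¬? (v ∈? S)) (∈-allFin v) v∉S)

chain-map : ∀ {R S : Fin n → Fin n → Set} → (∀ {u v} → R u v → S u v) → ∀ {xs} → Chain R xs → Chain S xs
chain-map f []        = []
chain-map f ([-] x)   = [-] x
chain-map f (r ∷ rs) = f r ∷ chain-map f rs

module _ (G : SimpleGraph n) where

  chain-ʳ++ : ∀ {x xs ys} → Chain (Adj G) (x ∷ xs) → Chain (Adj G) (x ∷ ys) → Chain (Adj G) (xs ʳ++ x ∷ ys)
  chain-ʳ++ ([-] _)    c = c
  chain-ʳ++ (e ∷ es) c = chain-ʳ++ es (symm G e ∷ c)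

  Covered : List (Fin n) → Set
  Covered S = Σ (List (Fin n)) λ Q → IsPath G Q × (∀ {v} → v ∈ S → v ∈ Q)

  path⇒covered : ∀ {Q} → IsPath G Q → Covered Q
  path⇒covered p = _ , p , λ v∈Q → v∈Q

  covered-weaken : ∀ {S T} → (∀ {v} → v ∈ S → v ∈ T) → Covered T → Covered S
  covered-weaken S⊆T (Q , p , T⊆Q) = Q , p , λ v∈S → T⊆Q (S⊆T v∈S)

  covered-↭ : ∀ {Q S} → Q ↭ S → Unique S → Chain (Adj G) Q → Covered S
  covered-↭ Q↭S uS c = _ , (unique-resp-↭ (↭-sym Q↭S) uS , c) , ∈-resp-↭ (↭-sym Q↭S)

module _ (H : SimpleGraph n) where

  pairDegreeIn : Fin n → Fin n → List (Fin n) → ℕ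
  pairDegreeIn x y S = count (adj? H x) S + count (adj? H y) S

  pairDegreeIn-++ : ∀ x y S T → pairDegreeIn x y (S ++ T) ≡ pairDegreeIn x y S + pairDegreeIn x y T
  pairDegreeIn-++ x y S T = trans (cong₂ _+_ (count-++ (adj? H x) S T) (count-++ (adj? H y) S T))
                                  (interchange (count (adj? H x) S) _ _ _)
    where
    interchange : ∀ a b c d → (a + b) + (c + d) ≡ (a + c) + (b + d)
    interchange = solve-∀

  pairDegreeIn-↭ : ∀ x y {S T} → S ↭ T → pairDegreeIn x y S ≡ pairDegreeIn x y T
  pairDegreeIn-↭ x y S↭T = cong₂ _+_ (count-↭ (adj? H x) S↭T) (count-↭ (adj? H y) S↭T)

  pairDegreeIn-++-< : ∀ x y {Q S T} → Q ↭ S ++ T →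
    pairDegreeIn x y S < length S → pairDegreeIn x y T < length T → suc (pairDegreeIn x y Q) < length Q
  pairDegreeIn-++-< x y {Q} {S} {T} Q↭S++T bS bT = begin
    suc (suc (pairDegreeIn x y Q))                        ≡⟨ cong (suc ∘ suc) (pairDegreeIn-↭ x y Q↭S++T) ⟩
    suc (suc (pairDegreeIn x y (S ++ T)))                 ≡⟨ cong (suc ∘ suc) (pairDegreeIn-++ x y S T) ⟩
    suc (suc (pairDegreeIn x y S + pairDegreeIn x y T))   ≡⟨ cong suc (sym (+-suc _ _)) ⟩
    suc (pairDegreeIn x y S) + suc (pairDegreeIn x y T)   ≤⟨ +-mono-≤ bS bT ⟩
    length S + length T                                   ≡⟨ sym (length-++ S) ⟩
    length (S ++ T)                                       ≡⟨ sym (↭-length Q↭S++T) ⟩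
    length Q                                              ∎
    where open ≤-Reasoning

  degree+degree< : ∀ x y Q → Unique Q → suc (pairDegreeIn x y Q) < length Q →
    pairDegreeIn x y (outside Q) ≤ length (outside Q) → degree H x + degree H y < n ∸ 1
  degree+degree< x y Q uQ bQ bO = begin-strict
    degree H x + degree H y                               ≡⟨ pairDegreeIn-↭ x y (↭-sym Q++O↭V) ⟩
    pairDegreeIn x y (Q ++ outside Q)                     ≡⟨ pairDegreeIn-++ x y Q (outside Q) ⟩
    pairDegreeIn x y Q + pairDegreeIn x y (outside Q)     <⟨ ∸-monoˡ-≤ 1 (+-mono-≤ bQ bO) ⟩
    (length Q + length (outside Q)) ∸ 1                   ≡⟨ cong (_∸ 1) (sym (length-++ Q)) ⟩
    length (Q ++ outside Q) ∸ 1                           ≡⟨ cong (_∸ 1) (↭-length Q++O↭V) ⟩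
    length (allFin n) ∸ 1                                 ≡⟨ cong (_∸ 1) (length-tabulate {n = n} id) ⟩
    n ∸ 1                                                 ∎
    where
    open ≤-Reasoning
    Q++O↭V : Q ++ outside Q ↭ allFin n
    Q++O↭V = ++-outside-↭ Q uQ

  Rotation : Fin n → List (Fin n) → Set
  Rotation x R = Σ (Fin n) λ r → Σ (List (Fin n)) λ t → Chain (Adj H) (r ∷ t) × Adj H x r × (r ∷ t ↭ R)

  -- A chain ending at y, in continuation form: it extends across every edge out of y.
  EndsAt : Fin n → List (Fin n) → Set
  EndsAt y xs = ∀ {z zs} → Adj H y z → Chain (Adj H) (z ∷ zs) → Chain (Adj H) (xs ++ z ∷ zs)

  -- The path scanned so far, from y to c, is kept reversed as c ∷ acc.
  rotate-from : ∀ x y c acc rest → Chain (Adj H) (c ∷ acc) → EndsAt y (c ∷ acc) → Chain (Adj H) (c ∷ rest) →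
    Rotation x (c ∷ acc ++ rest) ⊎ count (adj? H x) (c ∷ rest) + count (adj? H y) rest ≤ length rest
  rotate-from x y c acc [] ca _ _ with adj? H x c
  ... | yes x~c = inj₁ (c , acc , ca , x~c , ↭-reflexive (sym (++-identityʳ (c ∷ acc))))
  ... | no _    = inj₂ z≤n
  rotate-from x y c acc (z ∷ rest) ca end (c~z ∷ zr) with adj? H x c ×-dec adj? H y z
  ... | yes (x~c , y~z) = inj₁ (c , acc ++ z ∷ rest , end y~z zr , x~c , ↭-refl)
  ... | no ¬both with rotate-from x y z (c ∷ acc) rest (symm H c~z ∷ ca) (λ y~w wr → symm H c~z ∷ end y~w wr) zr
  ...   | inj₁ (r , t , rt , x~r , rt↭) = inj₁ (r , t , rt , x~r , ↭-trans rt↭ (↭-sym (shift z (c ∷ acc) rest)))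
  ...   | inj₂ bound                  = inj₂ (count-∷-≤ (adj? H x) (adj? H y) ¬both bound)

  rotate : ∀ x y R → Chain (Adj H) (y ∷ R) → Rotation x (y ∷ R) ⊎ suc (pairDegreeIn x y (y ∷ R)) ≤ length (y ∷ R)
  rotate x y R yR with rotate-from x y y [] R ([-] y) _∷_ yR
  ... | inj₁ rot   = inj₁ rot
  ... | inj₂ bound = inj₂ (s≤s (subst (λ k → count (adj? H x) (y ∷ R) + k ≤ length R)
                                      (sym (count-reject (adj? H y) R (irrefl H))) bound))

  join : ∀ x y L R → n ∸ 1 ≤ degree H x + degree H y →
    Chain (Adj H) (x ∷ L) → Chain (Adj H) (y ∷ R) → Unique (L ʳ++ x ∷ y ∷ R) → Covered H (L ʳ++ x ∷ y ∷ R)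
  join x y L R good xL yR uQ
    with rotate x y R yR | rotate y x L xL | any? (λ w → adj? H x w ×-dec adj? H y w) (outside (L ʳ++ x ∷ y ∷ R))
  ... | inj₁ (r , t , rt , x~r , rt↭) | _ | _ =
    covered-↭ H (↭-trans (ʳ++-↭-++ (x ∷ L) (r ∷ t)) (↭-trans (++⁺ˡ (x ∷ L) rt↭) (↭-sym (ʳ++-↭-++ (x ∷ L) (y ∷ R)))))
                uQ (chain-ʳ++ H xL (x~r ∷ rt))
  ... | inj₂ _ | inj₁ (h , t , ht , y~h , ht↭) | _ =
    covered-↭ H (↭-trans (ʳ++-↭-++ (h ∷ t) (y ∷ R)) (↭-trans (++⁺ʳ (y ∷ R) ht↭) (↭-sym (ʳ++-↭-++ (x ∷ L) (y ∷ R)))))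
                uQ (chain-ʳ++ H ht (symm H y~h ∷ yR))
  ... | inj₂ _ | inj₂ _ | yes common with find common
  ...   | w , w∈O , x~w , y~w =
    covered-weaken H there (covered-↭ H Q⁺↭ (¬Any⇒All¬ Q (∈-outside⁻ Q w∈O) ∷ uQ)
                                      (chain-ʳ++ H xL (x~w ∷ symm H y~w ∷ yR)))
    where
    Q = L ʳ++ x ∷ y ∷ R
    Q⁺↭ : L ʳ++ x ∷ w ∷ y ∷ R ↭ w ∷ Q
    Q⁺↭ = ↭-trans (ʳ++-↭-++ (x ∷ L) (w ∷ y ∷ R))
                  (↭-trans (shift w (x ∷ L) (y ∷ R)) (prep w (↭-sym (ʳ++-↭-++ (x ∷ L) (y ∷ R)))))
  join x y L R good xL yR uQ | inj₂ boundR | inj₂ boundL | no ¬common =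
    ⊥-elim (<⇒≱ (degree+degree< x y Q uQ (pairDegreeIn-++-< x y (ʳ++-↭-++ (x ∷ L) (y ∷ R)) boundL' boundR)
                                         (count+count≤length (adj? H x) (adj? H y) (¬Any⇒All¬ _ ¬common))) good)
    where
    Q = L ʳ++ x ∷ y ∷ R
    boundL' : pairDegreeIn x y (x ∷ L) < length (x ∷ L)
    boundL' = subst (_< length (x ∷ L)) (+-comm (count (adj? H y) (x ∷ L)) _) boundL

Joins : Fin n → Fin n → Fin n → Fin n → Set
Joins a b u v = (u ≡ a × v ≡ b) ⊎ (u ≡ b × v ≡ a)

joins-∈ : ∀ {a b x y u v : Fin n} → Joins a b x y → Joins a b u v → x ≡ u ⊎ x ≡ v
joins-∈ (inj₁ (refl , refl)) (inj₁ (refl , refl)) = inj₁ refl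
joins-∈ (inj₁ (refl , refl)) (inj₂ (refl , refl)) = inj₂ refl
joins-∈ (inj₂ (refl , refl)) (inj₁ (refl , refl)) = inj₂ refl
joins-∈ (inj₂ (refl , refl)) (inj₂ (refl , refl)) = inj₁ refl

addEdge : (G : SimpleGraph n) (a b : Fin n) → a ≢ b → SimpleGraph n
addEdge G a b a≢b = record
  { Adj    = λ u v → Adj G u v ⊎ Joins a b u v
  ; adj?   = λ u v → adj? G u v ⊎-dec (((u ≟ a) ×-dec (v ≟ b)) ⊎-dec ((u ≟ b) ×-dec (v ≟ a)))
  ; symm   = λ { (inj₁ e) → inj₁ (symm G e)
               ; (inj₂ (inj₁ (u≡a , v≡b))) → inj₂ (inj₂ (v≡b , u≡a))
               ; (inj₂ (inj₂ (u≡b , v≡a))) → inj₂ (inj₁ (v≡a , u≡b)) }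
  ; irrefl = λ { (inj₁ e) → irrefl G e
               ; (inj₂ (inj₁ (refl , refl))) → a≢b refl
               ; (inj₂ (inj₂ (refl , refl))) → a≢b refl } }

module _ (G : SimpleGraph n) {a b : Fin n} (a≢b : a ≢ b) where

  degree-addEdge : ∀ v → degree G v ≤ degree (addEdge G a b a≢b) v
  degree-addEdge v = count-mono (adj? G v) (adj? (addEdge G a b a≢b) v) inj₁ (allFin n)

  o₋₁-addEdge : ∀ {u v} → O₋₁Rel G u v → O₋₁Rel (addEdge G a b a≢b) u v
  o₋₁-addEdge (inj₁ e)        = inj₁ (inj₁ e)
  o₋₁-addEdge {u} {v} (inj₂ g) = inj₂ (≤-trans g (+-mono-≤ (degree-addEdge u) (degree-addEdge v)))

  chain-addEdge⁻ : ∀ {x y zs} → Joins a b x y → x ∉ zs → Chain (Adj (addEdge G a b a≢b)) zs → Chain (Adj G) zs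
  chain-addEdge⁻ xy x∉ []                 = []
  chain-addEdge⁻ xy x∉ ([-] z)            = [-] z
  chain-addEdge⁻ xy x∉ (inj₁ e ∷ es)      = e ∷ chain-addEdge⁻ xy (x∉ ∘ there) es
  chain-addEdge⁻ xy x∉ (inj₂ uv ∷ es) with joins-∈ xy uv
  ... | inj₁ refl = ⊥-elim (x∉ (here refl))
  ... | inj₂ refl = ⊥-elim (x∉ (there (here refl)))

  covered-addEdge : n ∸ 1 ≤ degree G a + degree G b → ∀ {S} → Covered (addEdge G a b a≢b) S → Covered G S
  covered-addEdge good ([] , _ , S⊆Q) = covered-weaken G S⊆Q (path⇒covered G ([] , []))
  covered-addEdge good ((c ∷ rest) , (uQ , cQ) , S⊆Q) = covered-weaken G S⊆Q (scan [] c rest uQ ([-] c) cQ)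
    where
    good-joins : ∀ {x y} → Joins a b x y → n ∸ 1 ≤ degree G x + degree G y
    good-joins (inj₁ (refl , refl)) = good
    good-joins (inj₂ (refl , refl)) = subst (n ∸ 1 ≤_) (+-comm (degree G a) _) good

    scan : ∀ acc c rest → Unique (acc ʳ++ c ∷ rest) →
      Chain (Adj G) (c ∷ acc) → Chain (Adj (addEdge G a b a≢b)) (c ∷ rest) → Covered G (acc ʳ++ c ∷ rest)
    scan acc c []         u ca _              = path⇒covered G (u , chain-ʳ++ G ca ([-] c))
    scan acc c (d ∷ rest) u ca (inj₁ e ∷ es)  = scan (c ∷ acc) d rest u (symm G e ∷ ca) es
    scan acc c (d ∷ rest) u ca (inj₂ cd ∷ es) =
      join G c d acc rest (good-joins cd) ca (chain-addEdge⁻ cd (ʳ++-∉ acc u) es) u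

o₋₁-covered : ∀ (G : SimpleGraph n) acc x rest → Unique (acc ʳ++ x ∷ rest) →
  Chain (Adj G) (x ∷ acc) → Chain (O₋₁Rel G) (x ∷ rest) → Covered G (acc ʳ++ x ∷ rest)
o₋₁-covered G acc x []         u xa _             = path⇒covered G (u , chain-ʳ++ G xa ([-] x))
o₋₁-covered G acc x (y ∷ rest) u xa (inj₁ e ∷ os) = o₋₁-covered G (x ∷ acc) y rest u (symm G e ∷ xa) os
o₋₁-covered G acc x (y ∷ rest) u xa (inj₂ g ∷ os) =
  covered-addEdge G x≢y g
    (o₋₁-covered (addEdge G x y x≢y) (x ∷ acc) y rest u (inj₂ (inj₂ (refl , refl)) ∷ chain-map inj₁ xa)
                 (chain-map (o₋₁-addEdge G x≢y) os))
  where
  x≢y : x ≢ y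
  x≢y x≡y = ʳ++-∉ acc u (here x≡y)

lemma1 : (n : ℕ) (G : SimpleGraph n) (P : List (Fin n)) → IsO₋₁Path G P →
    Σ (List (Fin n)) (λ Q → IsPath G Q × (∀ {v} → v ∈ P → v ∈ Q))
lemma1 n G []      _        = path⇒covered G ([] , [])
lemma1 n G (x ∷ P) (uP , oP) = o₋₁-covered G [] x P uP ([-] x) oP
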